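{- Let $n\geq 2$ be an integer such that a projective plane of order $n$ exists, and let $m\geq n^2+n+1$. Let $G=(V,E)$ be an $(n+1)$-uniform hypergraph with $V=[n^2+n+1]$ and edge set $E\subseteq\mathcal{F}_{n+1}^{V}$ such that $(V,E)$, with the edges as lines, forms a projective plane of order $n$. Then $E$ is a maximal simplex of the Vietoris–Rips complex $\mathcal{VR}(\mathcal{F}_{n+1}^{[m]};2n)$.
   Context: $[m]=\{1,\dots,m\}$. For $S\subseteq[m]$ with $|S|\geq k$, $\mathcal{F}_k^{S}$ denotes the set of all $k$-element subsets of $S$, with metric $d(A,B)=|A\triangle B|$. For a metric space $(X,d)$ and $r\ge 0$, $\mathcal{VR}(X;r)$ is the simplicial complex on $X$ whose simplices are the nonempty finite $\sigma\subseteq X$ with $d(x,y)\leq r$ for all $x,y\in\sigma$. A maximal simplex is one not properly contained in another simplex. A projective plane of order $n\geq 2$ is a finite set of points together with a family of subsets (lines) such that every line contains $n+1$ points, every point lies on $n+1$ lines, any two distinct lines meet in exactly one point, and any two distinct points lie on exactly one line. -}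

module Defs where

open import Data.Nat using (ℕ; _+_; _*_; _≤_; _<_)
open import Data.Fin using (Fin; toℕ)
open import Data.Fin.Subset using (Subset; ∣_∣; _∪_; _∩_; _─_) renaming (_∈_ to _∈ₛ_)
open import Data.List using (List; []; _∷_; length; filter)
open import Data.List.Membership.Propositional using (_∈_)
open import Data.List.Relation.Unary.Unique.Propositional using (Unique)
open import Data.Product using (_×_; ∃-syntax)
open import Relation.Binary.PropositionalEquality using (_≡_; _≢_)
open import Relation.Nullary using (¬_)
open import Data.Fin.Subset.Properties using (_∈?_)

d : ∀ {m} → Subset m → Subset m → ℕ
d A B = ∣ (A ─ B) ∪ (B ─ A) ∣

InF : ∀ {m} → ℕ → Subset m → Set
InF k A = ∣ A ∣ ≡ k

-- A (finite) set of vertices of VR(F_k^[m]; r), represented as a list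
-- (the set of its entries).  It is a simplex iff nonempty, all entries lie
-- in F_k^[m], and all pairwise distances are ≤ r.
IsVRSimplex : ∀ {m} → ℕ → ℕ → List (Subset m) → Set
IsVRSimplex k r σ =
  (∃[ A ] A ∈ σ)
  × (∀ {A} → A ∈ σ → InF k A)
  × (∀ {A B} → A ∈ σ → B ∈ σ → d A B ≤ r)

_⊆ₗ_ : ∀ {m} → List (Subset m) → List (Subset m) → Set
σ ⊆ₗ τ = ∀ {A} → A ∈ σ → A ∈ τ

IsMaximalVRSimplex : ∀ {m} → ℕ → ℕ → List (Subset m) → Set
IsMaximalVRSimplex k r σ =
  IsVRSimplex k r σ × (∀ τ → IsVRSimplex k r τ → σ ⊆ₗ τ → τ ⊆ₗ σ)

InV : ∀ {m} → ℕ → Fin m → Set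
InV N p = toℕ p < N

linesThrough : ∀ {m} → Fin m → List (Subset m) → ℕ
linesThrough p E = length (filter (p ∈?_) E)

-- (V, E) with V = [n²+n+1] ⊆ [m] and E a set of lines (a duplicate-free list of
-- subsets of [m]) is a projective plane of order n.
IsProjectivePlane : ∀ {m} → ℕ → List (Subset m) → Set
IsProjectivePlane {m} n E =
  Unique E
  × (∀ {L} → L ∈ E → ∀ {p} → p ∈ₛ L → InV N p)
  × (∀ {L} → L ∈ E → ∣ L ∣ ≡ n + 1)
  × (∀ (p : Fin m) → InV N p → linesThrough p E ≡ n + 1)
  × (∀ {L L'} → L ∈ E → L' ∈ E → L ≢ L' → ∣ L ∩ L' ∣ ≡ 1)
  × (∀ (p q : Fin m) → InV N p → InV N q → p ≢ q →
       (∃[ L ] (L ∈ E × p ∈ₛ L × q ∈ₛ L))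
       × (∀ {L L'} → L ∈ E → L' ∈ E → p ∈ₛ L → q ∈ₛ L → p ∈ₛ L' → q ∈ₛ L' → L ≡ L'))
  where N = n * n + n + 1

{-# OPTIONS --safe #-}
module Submission where

-- Two (n+1)-sets are at distance at most 2n exactly when they meet.  Hence E is a
-- simplex, since any two lines meet, and every vertex A of a simplex containing E is
-- an (n+1)-set meeting every line.  Such an A is a line: the n+1 lines through a
-- point p of the plane outside A meet A in pairwise disjoint nonempty sets, so each
-- of them meets A in exactly one point.  Consequently the line through two points
-- of A has no point outside A, and having the same size as A, it is A.

open import Data.Fin using (Fin; zero; suc; fromℕ<)
import Data.Fin as Fin
open import Data.Fin.Properties using (any?; toℕ-fromℕ<)
open import Data.Fin.Subset
  using (Subset; inside; outside; ∣_∣; _∩_; _─_; _-_; _⊆_; _∉_; Nonempty)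
  renaming (_∈_ to _∈ₛ_)
open import Data.Fin.Subset.Properties
  using ( _∈?_; ⊆-antisym; p⊂q⇒∣p∣<∣q∣; x∈p⇒∣p-x∣<∣p∣; x∈p∧x≢y⇒x∈p-y
        ; x∈p∧x∉q⇒x∈p─q; x∈p∩q⁺; x∈p∩q⁻; p∩q⊆p; ∩-idem; drop-∷-⊆)
open import Data.List using (List; []; _∷_; length; map; filter; lookup)
open import Data.List.Membership.Propositional using (_∈_)
open import Data.List.Membership.Propositional.Properties using (∈-filter⁺; ∈-filter⁻; ∈-lookup)
open import Data.List.Relation.Unary.All as All using (All; []; _∷_)
open import Data.List.Relation.Unary.AllPairs using (_∷_)
open import Data.List.Relation.Unary.Any using (here; there)
open import Data.List.Relation.Unary.Unique.Propositional using (Unique)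
open import Data.List.Relation.Unary.Unique.Propositional.Properties as Unique using ()
open import Data.Nat using (ℕ; suc; _+_; _*_; _≤_; _<_; z≤n; s≤s; s≤s⁻¹)
open import Data.Nat.ListAction using (sum)
open import Data.Nat.Properties
open import Data.Product using (∃; ∃₂; ∃-syntax; _×_; _,_; proj₁; proj₂)
open import Data.Sum using (_⊎_; inj₁; inj₂)
open import Data.Vec using ([]; _∷_; here; there)
open import Data.Vec.Properties using (≡-dec)
import Data.Bool as Bool
open import Function using (_∘_)
open import Relation.Binary.PropositionalEquality
open import Relation.Nullary using (yes; no; contradiction; ¬?; _×-dec_)
open import Relation.Nullary.Decidable using (decidable-stable)

open import Defs

private
  variable
    k : ℕ
    p q : Subset k
    x y : Fin k

x∈p⇒0<∣p∣ : x ∈ₛ p → 0 < ∣ p ∣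
x∈p⇒0<∣p∣ x∈p = ≤-trans (s≤s z≤n) (x∈p⇒∣p-x∣<∣p∣ x∈p)

0<∣p∣⇒Nonempty : 0 < ∣ p ∣ → Nonempty p
0<∣p∣⇒Nonempty {p = inside ∷ p} _ = zero , here
0<∣p∣⇒Nonempty {p = outside ∷ p} 0<∣p∣ =
  let x , x∈p = 0<∣p∣⇒Nonempty 0<∣p∣ in suc x , there x∈p

∣p∣≤1⇒x≡y : ∣ p ∣ ≤ 1 → x ∈ₛ p → y ∈ₛ p → x ≡ y
∣p∣≤1⇒x≡y {p = p} {x = x} {y} ∣p∣≤1 x∈p y∈p with x Fin.≟ y
... | yes x≡y = x≡y
... | no x≢y = contradiction ∣p∣≤1 (<⇒≱ (≤-trans (s≤s 0<∣p-x∣) (x∈p⇒∣p-x∣<∣p∣ x∈p)))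
  where
  0<∣p-x∣ : 0 < ∣ p - x ∣
  0<∣p-x∣ = x∈p⇒0<∣p∣ (x∈p∧x≢y⇒x∈p-y y∈p (x≢y ∘ sym))

p⊆q⇒∣q∣≤∣p∣⇒p≡q : p ⊆ q → ∣ q ∣ ≤ ∣ p ∣ → p ≡ q
p⊆q⇒∣q∣≤∣p∣⇒p≡q {p = p} p⊆q ∣q∣≤∣p∣ = ⊆-antisym p⊆q λ {x} x∈q →
  decidable-stable (x ∈? p) λ x∉p → <⇒≱ (p⊂q⇒∣p∣<∣q∣ (p⊆q , x , x∈q , x∉p)) ∣q∣≤∣p∣

p⊆q⊎∃x∈p∖q : ∀ (p q : Subset k) → p ⊆ q ⊎ ∃ λ x → x ∈ₛ p × x ∉ q
p⊆q⊎∃x∈p∖q p q with any? (λ x → x ∈? p ×-dec ¬? (x ∈? q))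
... | yes x∈p∖q = inj₂ x∈p∖q
... | no ∄x∈p∖q = inj₁ λ {x} x∈p → decidable-stable (x ∈? q) λ x∉q → ∄x∈p∖q (x , x∈p , x∉q)

d+2∣p∩q∣≡∣p∣+∣q∣ : ∀ (p q : Subset k) → d p q + 2 * ∣ p ∩ q ∣ ≡ ∣ p ∣ + ∣ q ∣
d+2∣p∩q∣≡∣p∣+∣q∣ [] [] = refl
d+2∣p∩q∣≡∣p∣+∣q∣ (outside ∷ p) (outside ∷ q) = d+2∣p∩q∣≡∣p∣+∣q∣ p q
d+2∣p∩q∣≡∣p∣+∣q∣ (outside ∷ p) (inside ∷ q) =
  trans (cong suc (d+2∣p∩q∣≡∣p∣+∣q∣ p q)) (sym (+-suc ∣ p ∣ ∣ q ∣))
d+2∣p∩q∣≡∣p∣+∣q∣ (inside ∷ p) (outside ∷ q) = cong suc (d+2∣p∩q∣≡∣p∣+∣q∣ p q)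
d+2∣p∩q∣≡∣p∣+∣q∣ (inside ∷ p) (inside ∷ q) = begin
  d p q + 2 * suc ∣ p ∩ q ∣       ≡⟨ cong (d p q +_) (*-suc 2 ∣ p ∩ q ∣) ⟩
  d p q + suc (suc (2 * ∣ p ∩ q ∣)) ≡⟨ +-suc (d p q) _ ⟩
  suc (d p q + suc (2 * ∣ p ∩ q ∣)) ≡⟨ cong suc (+-suc (d p q) _) ⟩
  suc (suc (d p q + 2 * ∣ p ∩ q ∣)) ≡⟨ cong (λ z → suc (suc z)) (d+2∣p∩q∣≡∣p∣+∣q∣ p q) ⟩
  suc (suc (∣ p ∣ + ∣ q ∣))         ≡⟨ cong suc (+-suc ∣ p ∣ ∣ q ∣) ⟨
  suc ∣ p ∣ + suc ∣ q ∣             ∎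
  where open ≡-Reasoning

p⊆q⇒∣p∣+∣q─p∣≡∣q∣ : p ⊆ q → ∣ p ∣ + ∣ q ─ p ∣ ≡ ∣ q ∣
p⊆q⇒∣p∣+∣q─p∣≡∣q∣ {p = []} {[]} _ = refl
p⊆q⇒∣p∣+∣q─p∣≡∣q∣ {p = inside ∷ p} {inside ∷ q} p⊆q = cong suc (p⊆q⇒∣p∣+∣q─p∣≡∣q∣ (drop-∷-⊆ p⊆q))
p⊆q⇒∣p∣+∣q─p∣≡∣q∣ {p = inside ∷ p} {outside ∷ q} p⊆q = contradiction (p⊆q here) λ ()
p⊆q⇒∣p∣+∣q─p∣≡∣q∣ {p = outside ∷ p} {inside ∷ q} p⊆q =
  trans (+-suc ∣ p ∣ _) (cong suc (p⊆q⇒∣p∣+∣q─p∣≡∣q∣ (drop-∷-⊆ p⊆q)))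
p⊆q⇒∣p∣+∣q─p∣≡∣q∣ {p = outside ∷ p} {outside ∷ q} p⊆q = p⊆q⇒∣p∣+∣q─p∣≡∣q∣ (drop-∷-⊆ p⊆q)

sum-disjoint≤ : ∀ {I : Set} (f : I → Subset k) {q : Subset k} {is : List I} → Unique is
  → (∀ {i} → i ∈ is → f i ⊆ q)
  → (∀ {i j x} → i ∈ is → j ∈ is → x ∈ₛ f i → x ∈ₛ f j → i ≡ j)
  → sum (map (λ i → ∣ f i ∣) is) ≤ ∣ q ∣
sum-disjoint≤ f {is = []} _ _ _ = z≤n
sum-disjoint≤ f {q} {i ∷ is} (i∉is ∷ unique) ⊆q disjoint = begin
  ∣ f i ∣ + sum (map (λ j → ∣ f j ∣) is)
    ≤⟨ +-monoʳ-≤ ∣ f i ∣ (sum-disjoint≤ f unique ⊆q─fi disjoint′) ⟩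
  ∣ f i ∣ + ∣ q ─ f i ∣                  ≡⟨ p⊆q⇒∣p∣+∣q─p∣≡∣q∣ (⊆q (here refl)) ⟩
  ∣ q ∣                                  ∎
  where
  open ≤-Reasoning
  ⊆q─fi : ∀ {j} → j ∈ is → f j ⊆ q ─ f i
  ⊆q─fi j∈is x∈fj = x∈p∧x∉q⇒x∈p─q (⊆q (there j∈is) x∈fj)
    λ x∈fi → All.lookup i∉is j∈is (disjoint (here refl) (there j∈is) x∈fi x∈fj)
  disjoint′ : ∀ {j j′ x} → j ∈ is → j′ ∈ is → x ∈ₛ f j → x ∈ₛ f j′ → j ≡ j′
  disjoint′ j∈is j′∈is = disjoint (there j∈is) (there j′∈is)

module _ {n : ℕ} {A B : Subset k} (∣A∣≡n+1 : ∣ A ∣ ≡ n + 1) (∣B∣≡n+1 : ∣ B ∣ ≡ n + 1) where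

  private
    d+2∣A∩B∣≡2n+2 : d A B + 2 * ∣ A ∩ B ∣ ≡ 2 * n + 2
    d+2∣A∩B∣≡2n+2 = begin
      d A B + 2 * ∣ A ∩ B ∣ ≡⟨ d+2∣p∩q∣≡∣p∣+∣q∣ A B ⟩
      ∣ A ∣ + ∣ B ∣         ≡⟨ cong₂ _+_ ∣A∣≡n+1 ∣B∣≡n+1 ⟩
      (n + 1) + (n + 1)     ≡⟨ cong ((n + 1) +_) (+-identityʳ (n + 1)) ⟨
      2 * (n + 1)           ≡⟨ *-distribˡ-+ 2 n 1 ⟩
      2 * n + 2             ∎
      where open ≡-Reasoning

  intersect⇒d≤2n : 0 < ∣ A ∩ B ∣ → d A B ≤ 2 * n
  intersect⇒d≤2n 0<∣A∩B∣ = +-cancelʳ-≤ 2 (d A B) (2 * n) (begin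
    d A B + 2             ≤⟨ +-monoʳ-≤ (d A B) (*-monoʳ-≤ 2 0<∣A∩B∣) ⟩
    d A B + 2 * ∣ A ∩ B ∣ ≡⟨ d+2∣A∩B∣≡2n+2 ⟩
    2 * n + 2             ∎)
    where open ≤-Reasoning

  d≤2n⇒intersect : d A B ≤ 2 * n → 0 < ∣ A ∩ B ∣
  d≤2n⇒intersect d≤2n = n≢0⇒n>0 λ ∣A∩B∣≡0 → <⇒≱ (m<m+n (2 * n) (s≤s z≤n)) (begin
    2 * n + 2             ≡⟨ d+2∣A∩B∣≡2n+2 ⟨
    d A B + 2 * ∣ A ∩ B ∣ ≡⟨ cong (λ i → d A B + 2 * i) ∣A∩B∣≡0 ⟩
    d A B + 0             ≡⟨ +-identityʳ (d A B) ⟩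
    d A B                 ≤⟨ d≤2n ⟩
    2 * n                 ∎)
    where open ≤-Reasoning

length≤sum : ∀ {I : Set} (f : I → ℕ) {is : List I} → All (λ i → 1 ≤ f i) is → length is ≤ sum (map f is)
length≤sum f [] = z≤n
length≤sum f (1≤fi ∷ 1≤f) = +-mono-≤ 1≤fi (length≤sum f 1≤f)

sum≤length⇒all≤1 : ∀ {I : Set} (f : I → ℕ) {is : List I}
  → All (λ i → 1 ≤ f i) is → sum (map f is) ≤ length is → All (λ i → f i ≤ 1) is
sum≤length⇒all≤1 f [] _ = []
sum≤length⇒all≤1 f {i ∷ is} (1≤fi ∷ 1≤f) sum≤length = fi≤1 ∷ sum≤length⇒all≤1 f 1≤f rest≤length
  where
  fi≤1 : f i ≤ 1
  fi≤1 = +-cancelʳ-≤ (sum (map f is)) (f i) 1 (≤-trans sum≤length (s≤s (length≤sum f 1≤f)))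
  rest≤length : sum (map f is) ≤ length is
  rest≤length = s≤s⁻¹ (≤-trans (+-monoˡ-≤ (sum (map f is)) 1≤fi) sum≤length)

∃-distinct-pair : ∀ {I : Set} {is : List I} → Unique is → 2 ≤ length is → ∃₂ λ i j → i ∈ is × j ∈ is × i ≢ j
∃-distinct-pair {is = i ∷ j ∷ _} ((i≢j ∷ _) ∷ _) _ = i , j , here refl , there (here refl) , i≢j
∃-distinct-pair {is = _ ∷ []} _ (s≤s ())

module ProjectivePlane {m n : ℕ} {E : List (Subset m)} (plane : IsProjectivePlane n E) where

  private
    N : ℕ
    N = n * n + n + 1

    variable
      a b c : Fin m
      A L L′ : Subset m

  Unique-lines : Unique E
  Unique-lines = proj₁ plane

  line⊆V : L ∈ E → a ∈ₛ L → InV N a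
  line⊆V L∈E = proj₁ (proj₂ plane) L∈E

  ∣line∣ : L ∈ E → ∣ L ∣ ≡ n + 1
  ∣line∣ = proj₁ (proj₂ (proj₂ plane))

  pencil-size : InV N a → linesThrough a E ≡ n + 1
  pencil-size = proj₁ (proj₂ (proj₂ (proj₂ plane))) _

  lines-meet : L ∈ E → L′ ∈ E → L ≢ L′ → ∣ L ∩ L′ ∣ ≡ 1
  lines-meet = proj₁ (proj₂ (proj₂ (proj₂ (proj₂ plane))))

  line-through : InV N a → InV N b → a ≢ b → ∃[ L ] (L ∈ E × a ∈ₛ L × b ∈ₛ L)
  line-through a∈V b∈V a≢b = proj₁ (proj₂ (proj₂ (proj₂ (proj₂ (proj₂ plane)))) _ _ a∈V b∈V a≢b)

  line-unique : L ∈ E → L′ ∈ E → a ≢ b → a ∈ₛ L → b ∈ₛ L → a ∈ₛ L′ → b ∈ₛ L′ → L ≡ L′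
  line-unique L∈E L′∈E a≢b a∈L b∈L =
    proj₂ (proj₂ (proj₂ (proj₂ (proj₂ (proj₂ plane)))) _ _ (line⊆V L∈E a∈L) (line⊆V L∈E b∈L) a≢b)
      L∈E L′∈E a∈L b∈L

  line⊆⇒≡ : L ∈ E → ∣ A ∣ ≡ n + 1 → L ⊆ A → L ≡ A
  line⊆⇒≡ L∈E ∣A∣≡n+1 L⊆A = p⊆q⇒∣q∣≤∣p∣⇒p≡q L⊆A (≤-reflexive (trans ∣A∣≡n+1 (sym (∣line∣ L∈E))))

  lines-close : L ∈ E → L′ ∈ E → d L L′ ≤ 2 * n
  lines-close {L} {L′} L∈E L′∈E = intersect⇒d≤2n {A = L} {B = L′} (∣line∣ L∈E) (∣line∣ L′∈E) 0<∣L∩L′∣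
    where
    0<∣L∩L′∣ : 0 < ∣ L ∩ L′ ∣
    0<∣L∩L′∣ with ≡-dec Bool._≟_ L L′
    ... | yes refl = subst (0 <_) (sym (trans (cong ∣_∣ (∩-idem L)) (∣line∣ L∈E))) (m≤n+m 1 n)
    ... | no L≢L′ = ≤-reflexive (sym (lines-meet L∈E L′∈E L≢L′))

  pencil : Fin m → List (Subset m)
  pencil a = filter (a ∈?_) E

  Unique-pencil : Unique (pencil a)
  Unique-pencil {a} = Unique.filter⁺ (a ∈?_) Unique-lines

  ∈-pencil⁺ : L ∈ E → a ∈ₛ L → L ∈ pencil a
  ∈-pencil⁺ {a = a} = ∈-filter⁺ (a ∈?_)

  ∈-pencil⁻ : L ∈ pencil a → L ∈ E × a ∈ₛ L
  ∈-pencil⁻ {a = a} = ∈-filter⁻ (a ∈?_)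

  line-exists : N ≤ m → ∃[ L ] L ∈ E
  line-exists N≤m = lookup (pencil a₀) i₀ , proj₁ (∈-pencil⁻ (∈-lookup i₀))
    where
    0<N : 0 < N
    0<N = m≤n+m 1 (n * n + n)
    a₀ : Fin m
    a₀ = fromℕ< (≤-trans 0<N N≤m)
    a₀∈V : InV N a₀
    a₀∈V = subst (_< N) (sym (toℕ-fromℕ< _)) 0<N
    i₀ : Fin (length (pencil a₀))
    i₀ = fromℕ< (subst (0 <_) (sym (pencil-size a₀∈V)) (m≤n+m 1 n))

  Blocking : Subset m → Set
  Blocking A = ∀ {L} → L ∈ E → 0 < ∣ A ∩ L ∣

  blocking⇒∣A∩L∣≤1 : ∣ A ∣ ≡ n + 1 → Blocking A → InV N a → a ∉ A → L ∈ E → a ∈ₛ L → ∣ A ∩ L ∣ ≤ 1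
  blocking⇒∣A∩L∣≤1 {A} {a} ∣A∣≡n+1 blocking a∈V a∉A L∈E a∈L =
    All.lookup (sum≤length⇒all≤1 (λ L → ∣ A ∩ L ∣) (All.tabulate (blocking ∘ proj₁ ∘ ∈-pencil⁻))
                                 sum≤length)
               (∈-pencil⁺ L∈E a∈L)
    where
    disjoint : ∀ {L L′ x} → L ∈ pencil a → L′ ∈ pencil a → x ∈ₛ A ∩ L → x ∈ₛ A ∩ L′ → L ≡ L′
    disjoint {L} {L′} L∈pencil L′∈pencil x∈A∩L x∈A∩L′ =
      let L∈E , a∈L = ∈-pencil⁻ L∈pencil ; L′∈E , a∈L′ = ∈-pencil⁻ L′∈pencil
          x∈A , x∈L = x∈p∩q⁻ A L x∈A∩L
      in line-unique L∈E L′∈E (λ { refl → a∉A x∈A }) a∈L x∈L a∈L′ (proj₂ (x∈p∩q⁻ A L′ x∈A∩L′))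
    sum≤length : sum (map (λ L → ∣ A ∩ L ∣) (pencil a)) ≤ length (pencil a)
    sum≤length = begin
      sum (map (λ L → ∣ A ∩ L ∣) (pencil a))
        ≤⟨ sum-disjoint≤ (A ∩_) Unique-pencil (λ _ → p∩q⊆p A _) disjoint ⟩
      ∣ A ∣                                   ≡⟨ ∣A∣≡n+1 ⟩
      n + 1                                   ≡⟨ pencil-size a∈V ⟨
      length (pencil a)                       ∎
      where open ≤-Reasoning

  blocking⇒two-points : 1 ≤ n → Blocking A → InV N a → a ∉ A →
    ∃₂ λ b c → (b ∈ₛ A × InV N b) × (c ∈ₛ A × InV N c) × b ≢ c
  blocking⇒two-points {A} {a} 1≤n blocking a∈V a∉A
    with L₁ , L₂ , L₁∈pencil , L₂∈pencil , L₁≢L₂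
           ← ∃-distinct-pair Unique-pencil (subst (2 ≤_) (sym (pencil-size a∈V)) (+-monoˡ-≤ 1 1≤n))
    with L₁∈E , a∈L₁ ← ∈-pencil⁻ L₁∈pencil | L₂∈E , a∈L₂ ← ∈-pencil⁻ L₂∈pencil
    with b , b∈A∩L₁ ← 0<∣p∣⇒Nonempty (blocking L₁∈E) | c , c∈A∩L₂ ← 0<∣p∣⇒Nonempty (blocking L₂∈E)
    with b∈A , b∈L₁ ← x∈p∩q⁻ A L₁ b∈A∩L₁ | c∈A , c∈L₂ ← x∈p∩q⁻ A L₂ c∈A∩L₂
    = b , c , (b∈A , line⊆V L₁∈E b∈L₁) , (c∈A , line⊆V L₂∈E c∈L₂) , b≢c
    where
    b≢c : b ≢ c
    b≢c refl = L₁≢L₂ (line-unique L₁∈E L₂∈E (λ { refl → a∉A b∈A }) a∈L₁ b∈L₁ a∈L₂ c∈L₂)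

  blocking⇒line-through : ∣ A ∣ ≡ n + 1 → Blocking A → b ∈ₛ A → c ∈ₛ A → InV N b → InV N c → b ≢ c → A ∈ E
  blocking⇒line-through {A} ∣A∣≡n+1 blocking b∈A c∈A b∈V c∈V b≢c
    with L , L∈E , b∈L , c∈L ← line-through b∈V c∈V b≢c
    = subst (_∈ E) (line⊆⇒≡ L∈E ∣A∣≡n+1 L⊆A) L∈E
    where
    L⊆A : L ⊆ A
    L⊆A {x} x∈L = decidable-stable (x ∈? A) λ x∉A →
      b≢c (∣p∣≤1⇒x≡y (blocking⇒∣A∩L∣≤1 ∣A∣≡n+1 blocking (line⊆V L∈E x∈L) x∉A L∈E x∈L)
                     (x∈p∩q⁺ (b∈A , b∈L)) (x∈p∩q⁺ (c∈A , c∈L)))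

  blocking⇒line : 1 ≤ n → N ≤ m → ∣ A ∣ ≡ n + 1 → Blocking A → A ∈ E
  blocking⇒line {A} 1≤n N≤m ∣A∣≡n+1 blocking
    with L₀ , L₀∈E ← line-exists N≤m
    with p⊆q⊎∃x∈p∖q L₀ A
  ... | inj₁ L₀⊆A = subst (_∈ E) (line⊆⇒≡ L₀∈E ∣A∣≡n+1 L₀⊆A) L₀∈E
  ... | inj₂ (a , a∈L₀ , a∉A)
    with b , c , (b∈A , b∈V) , (c∈A , c∈V) , b≢c
           ← blocking⇒two-points 1≤n blocking (line⊆V L₀∈E a∈L₀) a∉A
    = blocking⇒line-through ∣A∣≡n+1 blocking b∈A c∈A b∈V c∈V b≢c

lemma3p2 : (n m : ℕ) → 2 ≤ n → n * n + n + 1 ≤ m → (E : List (Subset m))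
    → IsProjectivePlane n E
    → IsMaximalVRSimplex (n + 1) (2 * n) E
lemma3p2 n m 2≤n N≤m E plane = (line-exists N≤m , ∣line∣ , lines-close) , maximal
  where
  open ProjectivePlane plane
  maximal : ∀ τ → IsVRSimplex (n + 1) (2 * n) τ → E ⊆ₗ τ → τ ⊆ₗ E
  maximal τ (_ , τ⊆F , τ-close) E⊆τ {A} A∈τ =
    blocking⇒line (≤-trans (s≤s z≤n) 2≤n) N≤m (τ⊆F A∈τ)
      λ {L} L∈E → d≤2n⇒intersect {A = A} {B = L} (τ⊆F A∈τ) (∣line∣ L∈E) (τ-close A∈τ (E⊆τ L∈E))
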